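{- Let $T$ be a reduced set of permutations (each of length at least $2$) and let $\pi$ be a permutation of length $n$. If $s_T(\pi)=\rho$, then $s_{T^c}(\pi^c)=\rho^c$.
   Context: The complement of a permutation $\pi$ of length $n$ is $\pi^c=(n+1-\pi(1))(n+1-\pi(2))\cdots(n+1-\pi(n))$, and $T^c=\{\sigma^c:\sigma\in T\}$. A sequence of distinct integers contains a permutation $\tau$ if some subsequence is order-isomorphic to $\tau$; otherwise it avoids $\tau$. A set $T$ is reduced if no element of $T$ contains a different element of $T$. For a set $T$ of permutations, the map $s_T$ is defined by: read the input permutation left to right with an initially empty stack and output; at each step, if there is a next input element and pushing it keeps the stack contents, read from top to bottom, $T$-avoiding, push it; otherwise pop the top of the stack and append it to the output; stop when input and stack are empty; the output is $s_T(\pi)$. -}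

module Defs where

open import Data.Nat using (ℕ; suc; _∸_; _<_; _≤_)
open import Data.List using (List; []; _∷_; _++_; [_]; length; map; upTo; lookup)
open import Data.Fin using (Fin; cast)
open import Data.Product using (Σ; ∃; _×_)
open import Relation.Binary.PropositionalEquality using (_≡_; _≢_)
open import Relation.Nullary using (¬_)
open import Function.Bundles using (_⇔_)
open import Data.List.Relation.Binary.Sublist.Propositional using (_⊆_)
open import Data.List.Relation.Binary.Permutation.Propositional using (_↭_)

IsPerm : List ℕ → Set
IsPerm π = π ↭ map suc (upTo (length π))

OrderIso : List ℕ → List ℕ → Set
OrderIso xs ys = Σ (length xs ≡ length ys) λ eq →
  (i j : Fin (length xs)) →
    (lookup xs i < lookup xs j) ⇔ (lookup ys (cast eq i) < lookup ys (cast eq j))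

Contains : List ℕ → List ℕ → Set
Contains σ τ = ∃ λ sub → (sub ⊆ σ) × OrderIso sub τ

PermSet : Set₁
PermSet = List ℕ → Set

Avoids : PermSet → List ℕ → Set
Avoids T σ = ∀ τ → T τ → ¬ Contains σ τ

Reduced : PermSet → Set
Reduced T = ∀ σ τ → T σ → T τ → σ ≢ τ → ¬ Contains σ τ

complement : List ℕ → List ℕ
complement π = map (λ x → suc (length π) ∸ x) π

ComplementSet : PermSet → PermSet
ComplementSet T σ = ∃ λ τ → T τ × (σ ≡ complement τ)

-- Run T input stack output result : running the T-stack machine from the
-- configuration (remaining input, stack read top to bottom, output so far)
-- terminates with final output `result`.  The machine is deterministic:
-- exactly one rule applies in each configuration.
data Run (T : PermSet) : List ℕ → List ℕ → List ℕ → List ℕ → Set where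
  done     : ∀ {out} → Run T [] [] out out
  push     : ∀ {x xs st out ρ} → Avoids T (x ∷ st) →
             Run T xs (x ∷ st) out ρ → Run T (x ∷ xs) st out ρ
  pop-blk  : ∀ {x xs s st out ρ} → ¬ Avoids T (x ∷ s ∷ st) →
             Run T (x ∷ xs) st (out ++ [ s ]) ρ → Run T (x ∷ xs) (s ∷ st) out ρ
  pop-end  : ∀ {s st out ρ} →
             Run T [] st (out ++ [ s ]) ρ → Run T [] (s ∷ st) out ρ

StackSorts : PermSet → List ℕ → List ℕ → Set
StackSorts T π ρ = Run T π [] [] ρ

-- Reflection x ↦ n + 1 − x reverses the order of 1, …, n, so it carries
-- order-isomorphisms to order-isomorphisms; being an involution on 1, …, n it
-- turns occurrences of τ in a stack into occurrences of τᶜ in the reflected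
-- stack and back. Hence the Tᶜ-machine on πᶜ pushes exactly when the T-machine
-- on π does, and the two runs differ only by reflecting every entry.
module Submission where

open import Defs
open import Data.Nat using (ℕ; suc; _+_; _∸_; _≤_; _<_; s≤s; z≤n)
open import Data.Nat.Properties
  using (m∸[m∸n]≡n; m+n∸n≡m; ∸-monoʳ-≤; ∸-monoʳ-<; m≤n⇒m≤1+n; <⇒≱; ≮⇒≥; _<?_; +-suc; +-assoc; +-identityʳ)
open import Data.List using (List; []; _∷_; _++_; [_]; length; map; lookup; upTo)
open import Data.List.Properties using (length-map; length-++; map-++)
open import Data.List.Relation.Unary.All as All using (All; []; _∷_)
open import Data.List.Relation.Unary.All.Properties using (map⁺)
open import Data.List.Membership.Propositional using (_∈_)
open import Data.List.Membership.Propositional.Properties using (∈-map⁻; ∈-upTo⁻; ∈-lookup)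
open import Data.List.Relation.Binary.Permutation.Propositional.Properties using (∈-resp-↭)
open import Data.List.Relation.Binary.Sublist.Propositional.Properties
  using (All-resp-⊆) renaming (map⁺ to ⊆-map⁺)
open import Data.Fin using (Fin; cast) renaming (zero to fzero; suc to fsuc)
open import Data.Fin.Properties using (cast-trans)
open import Data.Product using (∃; _×_; _,_; proj₁; proj₂)
open import Function using (_∘_)
open import Function.Bundles using (_⇔_; mk⇔; Equivalence)
open import Function.Related.Propositional using (module EquationalReasoning; SK-sym)
open import Relation.Binary.PropositionalEquality
  using (_≡_; refl; sym; trans; cong; cong₂; subst; subst₂)
open import Relation.Nullary using (yes; no)
open import Data.Empty using (⊥-elim)

reflect : ℕ → ℕ → ℕ
reflect n x = suc n ∸ x

InRange : ℕ → ℕ → Set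
InRange n x = 1 ≤ x × x ≤ n

<⇔reflect-> : ∀ {n a b} → b ≤ suc n → a < b ⇔ reflect n b < reflect n a
<⇔reflect-> {n} {a} {b} b≤1+n = mk⇔ (λ a<b → ∸-monoʳ-< a<b b≤1+n) from
  where
  from : reflect n b < reflect n a → a < b
  from rb<ra with a <? b
  ... | yes a<b = a<b
  ... | no a≮b  = ⊥-elim (<⇒≱ rb<ra (∸-monoʳ-≤ (suc n) (≮⇒≥ a≮b)))

reflect-involutive : ∀ {n x} → x ≤ suc n → reflect n (reflect n x) ≡ x
reflect-involutive = m∸[m∸n]≡n

reflect-InRange : ∀ {n x} → InRange n x → InRange n (reflect n x)
reflect-InRange {n} {x} (1≤x , x≤n) =
  subst (_≤ reflect n x) (m+n∸n≡m 1 n) (∸-monoʳ-≤ (suc n) x≤n) , ∸-monoʳ-≤ (suc n) 1≤x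

map-reflect-involutive : ∀ {n xs} → All (_≤ suc n) xs → map (reflect n) (map (reflect n) xs) ≡ xs
map-reflect-involutive []         = refl
map-reflect-involutive (x≤ ∷ xs≤) = cong₂ _∷_ (reflect-involutive x≤) (map-reflect-involutive xs≤)

IsPerm⇒InRange : ∀ {π} → IsPerm π → All (InRange (length π)) π
IsPerm⇒InRange π↭ = All.tabulate λ x∈π → suc-InRange (∈-map⁻ suc (∈-resp-↭ π↭ x∈π))
  where
  suc-InRange : ∀ {n x} → ∃ (λ i → i ∈ upTo n × x ≡ suc i) → InRange n x
  suc-InRange (i , i∈ , refl) = s≤s z≤n , ∈-upTo⁻ i∈

lookup-map : ∀ (g : ℕ → ℕ) xs (i : Fin (length (map g xs))) →
  lookup (map g xs) i ≡ g (lookup xs (cast (length-map g xs) i))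
lookup-map g (x ∷ xs) fzero    = refl
lookup-map g (x ∷ xs) (fsuc i) = lookup-map g xs i

OrderIso-reflect : ∀ {n k xs ys} → All (_≤ n) xs → All (_≤ k) ys →
  OrderIso xs ys → OrderIso (map (reflect n) xs) (map (reflect k) ys)
OrderIso-reflect {n} {k} {xs} {ys} xs≤ ys≤ (xs≡ys , iso) = lengths≡ , λ i j →
  begin
    lookup (map (reflect n) xs) i < lookup (map (reflect n) xs) j
      ≡⟨ cong₂ _<_ (lookup-map (reflect n) xs i) (lookup-map (reflect n) xs j) ⟩
    reflect n (x i) < reflect n (x j)
      ∼⟨ SK-sym (<⇔reflect-> (m≤n⇒m≤1+n (All.lookup xs≤ (∈-lookup _)))) ⟩
    x j < x i
      ∼⟨ iso _ _ ⟩
    y j < y i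
      ∼⟨ <⇔reflect-> (m≤n⇒m≤1+n (All.lookup ys≤ (∈-lookup _))) ⟩
    reflect k (y i) < reflect k (y j)
      ≡⟨ sym (cong₂ _<_ (lookup-map-ys i) (lookup-map-ys j)) ⟩
    lookup (map (reflect k) ys) (cast lengths≡ i) < lookup (map (reflect k) ys) (cast lengths≡ j)
  ∎
  where
  open EquationalReasoning
  xs↦ = length-map (reflect n) xs
  ys↦ = length-map (reflect k) ys
  lengths≡ = trans xs↦ (trans xs≡ys (sym ys↦))
  x : Fin (length (map (reflect n) xs)) → ℕ
  x i = lookup xs (cast xs↦ i)
  y : Fin (length (map (reflect n) xs)) → ℕ
  y i = lookup ys (cast xs≡ys (cast xs↦ i))
  lookup-map-ys : ∀ i → lookup (map (reflect k) ys) (cast lengths≡ i) ≡ reflect k (y i)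
  lookup-map-ys i = trans (lookup-map (reflect k) ys (cast lengths≡ i))
    (cong (reflect k ∘ lookup ys)
      (trans (cast-trans lengths≡ ys↦ i) (sym (cast-trans xs↦ xs≡ys i))))

Contains-reflect : ∀ {n k s τ} → All (_≤ n) s → All (_≤ k) τ →
  Contains s τ → Contains (map (reflect n) s) (map (reflect k) τ)
Contains-reflect s≤ τ≤ (sub , sub⊆s , iso) =
  map _ sub , ⊆-map⁺ _ sub⊆s , OrderIso-reflect (All-resp-⊆ sub⊆s s≤) τ≤ iso

Contains-reflect⁻ : ∀ {n k s τ} → All (InRange n) s → All (InRange k) τ →
  Contains (map (reflect n) s) (map (reflect k) τ) → Contains s τ
Contains-reflect⁻ s∈ τ∈ =
  subst₂ Contains (map-reflect-involutive (≤suc s∈)) (map-reflect-involutive (≤suc τ∈))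
  ∘ Contains-reflect (reflected s∈) (reflected τ∈)
  where
  ≤suc : ∀ {n xs} → All (InRange n) xs → All (_≤ suc n) xs
  ≤suc = All.map (m≤n⇒m≤1+n ∘ proj₂)
  reflected : ∀ {n xs} → All (InRange n) xs → All (_≤ n) (map (reflect n) xs)
  reflected = map⁺ ∘ All.map (proj₂ ∘ reflect-InRange)

module _ {T : PermSet} (T-perms : ∀ τ → T τ → IsPerm τ) where

  Avoids-reflect : ∀ {n s} → All (InRange n) s →
    Avoids T s ⇔ Avoids (ComplementSet T) (map (reflect n) s)
  Avoids-reflect s∈ = mk⇔
    (λ { avoids _ (τ , τ∈T , refl) c →
      avoids τ τ∈T (Contains-reflect⁻ s∈ (IsPerm⇒InRange (T-perms τ τ∈T)) c) })
    (λ avoids τ τ∈T c →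
      avoids _ (τ , τ∈T , refl)
        (Contains-reflect (All.map proj₂ s∈) (All.map proj₂ (IsPerm⇒InRange (T-perms τ τ∈T))) c))

  Run-reflect : ∀ {n xs st out ρ} → All (InRange n) xs → All (InRange n) st →
    Run T xs st out ρ →
    Run (ComplementSet T) (map (reflect n) xs) (map (reflect n) st)
                          (map (reflect n) out) (map (reflect n) ρ)
  Run-reflect xs∈ st∈ done = done
  Run-reflect (x∈ ∷ xs∈) st∈ (push avoids run) =
    push (Equivalence.to (Avoids-reflect (x∈ ∷ st∈)) avoids) (Run-reflect xs∈ (x∈ ∷ st∈) run)
  Run-reflect {n} xs∈@(x∈ ∷ _) (s∈ ∷ st∈) (pop-blk {s = s} {out = out} blocked run) =
    pop-blk (blocked ∘ Equivalence.from (Avoids-reflect (x∈ ∷ s∈ ∷ st∈)))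
      (subst (λ o → Run _ _ _ o _) (map-++ (reflect n) out [ s ]) (Run-reflect xs∈ st∈ run))
  Run-reflect {n} [] (s∈ ∷ st∈) (pop-end {s = s} {out = out} run) =
    pop-end (subst (λ o → Run _ _ _ o _) (map-++ (reflect n) out [ s ]) (Run-reflect [] st∈ run))

length-snoc-+ : ∀ (out : List ℕ) {s} m → length (out ++ [ s ]) + m ≡ length out + suc m
length-snoc-+ out m = trans (cong (_+ m) (length-++ out)) (+-assoc (length out) 1 m)

Run-length : ∀ {T xs st out ρ} → Run T xs st out ρ →
  length ρ ≡ length out + (length st + length xs)
Run-length {out = out} done = sym (+-identityʳ (length out))
Run-length {xs = _ ∷ xs} {st} {out} (push _ run) =
  trans (Run-length run) (cong (length out +_) (sym (+-suc (length st) (length xs))))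
Run-length {xs = xs} {_ ∷ st} {out} (pop-blk _ run) =
  trans (Run-length run) (length-snoc-+ out (length st + length xs))
Run-length {st = _ ∷ st} {out} (pop-end run) =
  trans (Run-length run) (length-snoc-+ out (length st + 0))

-- The run is reflected about length π, whereas
-- complement ρ reflects about length ρ, hence Run-length.
lemma3p1 : (T : PermSet) →
    (∀ τ → T τ → IsPerm τ × (2 ≤ length τ)) →
    Reduced T →
    (π ρ : List ℕ) → IsPerm π →
    StackSorts T π ρ →
    StackSorts (ComplementSet T) (complement π) (complement ρ)
lemma3p1 T T-perms _ π ρ π-perm sorts =
  subst (λ m → StackSorts (ComplementSet T) (complement π) (map (reflect m) ρ))
    (sym (Run-length sorts))
    (Run-reflect (λ τ → proj₁ ∘ T-perms τ) (IsPerm⇒InRange π-perm) [] sorts)
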